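{- Let $\mathbb{H}_2 = (\mathbb{Z}[\tfrac{1}{2}, i], \langle i, 1-i\rangle)$, where $i$ is a root of $x^2+1$ (so $i=\sqrt{ -1}\in\mathbb{C}$) and $\langle i,1-i\rangle$ is the multiplicative subgroup of units generated by $i$ and $1-i$. The set of fundamental elements of $\mathbb{H}_2$ is $$\mathcal{F}(\mathbb{H}_2)=\left\{0,\,1,\,-1,\,2,\,\tfrac12,\,i,\,1+i,\,\tfrac{1+i}{2},\,1-i,\,\tfrac{1-i}{2},\,-i\right\}.$$
   Context: A partial field is a pair $\mathbb{P}=(R,G)$ of a commutative ring $R$ and a subgroup $G$ of the group of units of $R$ with $-1\in G$; we write $p\in\mathbb{P}$ if $p\in G\cup\{0\}$. An element $p$ of a partial field $\mathbb{P}$ is fundamental if $p\in\mathbb{P}$ and $1-p\in\mathbb{P}$; $\mathcal{F}(\mathbb{P})$ denotes the set of fundamental elements. -}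

module Defs where

open import Data.Nat using (ℕ; zero; suc) renaming (_^_ to _^ℕ_)
open import Data.Integer using (ℤ; +_; -[1+_])
open import Data.Rational using (ℚ; _/_; 0ℚ; 1ℚ; ½; -½; -_) renaming (_+_ to _+q_; _*_ to _*q_; _-_ to _-q_)
open import Data.Product using (∃; _×_)
open import Data.Sum using (_⊎_)
open import Relation.Binary.PropositionalEquality using (_≡_)

-- Gaussian rationals ℚ(i), an ambient field containing ℤ[1/2, i].
record ℚi : Set where
  constructor _+i_
  field
    re : ℚ
    im : ℚ
open ℚi public

infixl 6 _+_ _-_
infixl 7 _*_

_+_ : ℚi → ℚi → ℚi
(a +i b) + (c +i d) = (a +q c) +i (b +q d)

_-_ : ℚi → ℚi → ℚi
(a +i b) - (c +i d) = (a -q c) +i (b -q d)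

_*_ : ℚi → ℚi → ℚi
(a +i b) * (c +i d) = ((a *q c) -q (b *q d)) +i ((a *q d) +q (b *q c))

𝟘 𝟙 𝕚 : ℚi
𝟘 = 0ℚ +i 0ℚ
𝟙 = 1ℚ +i 0ℚ
𝕚 = 0ℚ +i 1ℚ

one-i one-i⁻¹ : ℚi
one-i = 1ℚ +i (- 1ℚ)
one-i⁻¹ = ½ +i ½

pow : ℚi → ℕ → ℚi
pow x zero = 𝟙
pow x (suc n) = x * pow x n

zpow-one-i : ℤ → ℚi
zpow-one-i (+ n) = pow one-i n
zpow-one-i -[1+ n ] = pow one-i⁻¹ (suc n)

-- membership in the ring ℤ[1/2, i]: 2^k p ∈ ℤ[i] for some k
InR : ℚi → Set
InR p = ∃ λ (k : ℕ) → ∃ λ (a : ℤ) → ∃ λ (b : ℤ) →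
  ((re p *q (+ (2 ^ℕ k) / 1)) ≡ a / 1) × ((im p *q (+ (2 ^ℕ k) / 1)) ≡ b / 1)

-- the subgroup ⟨i, 1-i⟩ of units (abelian, so its elements are i^a (1-i)^n)
InG : ℚi → Set
InG p = ∃ λ (a : ℕ) → ∃ λ (n : ℤ) → p ≡ pow 𝕚 a * zpow-one-i n

InP : ℚi → Set
InP p = (p ≡ 𝟘) ⊎ InG p

Fundamental : ℚi → Set
Fundamental p = InP p × InP (𝟙 - p)

-- Every element of ⟨i, 1 − i⟩ is X (s + t i) with X a power of two and s, t ∈ {−1, 0, 1}: this
-- shape is preserved by multiplication with i, 1 − i and (1 + i)/2. If p = X (a + b i) and
-- 1 − p = Y (c + d i) have this shape, then a X + c Y = 1 and b X + d Y = 0. Two distinct powers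
-- of two differ at least by a factor 2, so the first equation only has the solutions 0 + 1,
-- 1 + 0, ½ + ½, 2 − 1 and −1 + 2, while the second forces b = 0 unless X = Y. The surviving
-- combinations are the eleven listed elements.
module Submission where

open import Defs
  using (ℚi; _+i_; re; im; 𝟘; 𝟙; 𝕚; one-i; one-i⁻¹; pow; zpow-one-i; InR; InP; Fundamental)
  renaming (_*_ to _*ᵢ_)
open import Data.Nat using (ℕ; zero; suc; z≤n; s≤s) renaming (_≤_ to _≤ℕ_; _<_ to _<ℕ_)
import Data.Nat.Properties as ℕ
open import Data.Integer using (+_; -[1+_])
open import Data.Rational using (ℚ; 0ℚ; 1ℚ; ½; -½; -_; _/_; _+_; _*_; _-_; _≤_; _<_; _≟_)
import Data.Rational.Properties as ℚ
open import Data.Rational.Solver using (module +-*-Solver)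
open +-*-Solver using (solve; _:=_; con; _:+_; _:*_; _:-_; :-_)
open import Algebra.Properties.Group ℚ.+-0-group using (x∙y⁻¹≈ε⇒x≈y; ⁻¹-involutive)
open import Data.Product using (_,_)
open import Data.Sum using (inj₁; inj₂)
open import Data.Empty using (⊥-elim)
open import Data.List using (List; []; _∷_)
open import Data.List.Relation.Unary.All using (All; []; _∷_) renaming (lookup to All-lookup)
open import Data.List.Membership.Propositional using (_∈_)
open import Function using (_∘′_)
open import Function.Bundles using (_⇔_; mk⇔)
open import Relation.Nullary.Decidable using (True; toWitness; from-yes; map′; _×-dec_)
open import Relation.Binary.Definitions using (DecidableEquality)
open import Relation.Binary.PropositionalEquality

2^_ : ℕ → ℚ
2^ zero  = 1ℚ
2^ suc n = 2^ n + 2^ n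

½^_ : ℕ → ℚ
½^ zero  = 1ℚ
½^ suc n = ½ * ½^ n

data Pow2 : ℚ → Set where
  up   : ∀ n → Pow2 (2^ n)
  down : ∀ n → Pow2 (½^ suc n)

2ℚ : ℚ
2ℚ = 1ℚ + 1ℚ

0<1 : 0ℚ < 1ℚ
0<1 = ℚ.positive⁻¹ 1ℚ

neg<0 : ∀ {X} → 0ℚ < X → - X < 0ℚ
neg<0 = ℚ.neg-antimono-<

p<p+q : ∀ p {q} → 0ℚ < q → p < p + q
p<p+q p 0<q = subst (_< p + _) (ℚ.+-identityʳ p) (ℚ.+-monoʳ-< p 0<q)

+-cancelˡ-≤ : ∀ r {p q} → r + p ≤ r + q → p ≤ q
+-cancelˡ-≤ r r+p≤r+q = ℚ.≮⇒≥ λ q<p → ℚ.<-irrefl refl (ℚ.<-≤-trans (ℚ.+-monoʳ-< r q<p) r+p≤r+q)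

+-cancelʳ-≤ : ∀ r {p q} → p + r ≤ q + r → p ≤ q
+-cancelʳ-≤ r p+r≤q+r = ℚ.≮⇒≥ λ q<p → ℚ.<-irrefl refl (ℚ.<-≤-trans (ℚ.+-monoˡ-< r q<p) p+r≤q+r)

2^-≥1 : ∀ n → 1ℚ ≤ 2^ n
2^-≥1 zero    = ℚ.≤-refl
2^-≥1 (suc n) = ℚ.≤-trans (from-yes (1ℚ ℚ.≤? 2ℚ)) (ℚ.+-mono-≤ (2^-≥1 n) (2^-≥1 n))

2^-mono-≤ : ∀ {m n} → m ≤ℕ n → 2^ m ≤ 2^ n
2^-mono-≤ {n = n} z≤n = 2^-≥1 n
2^-mono-≤ (s≤s m≤n)   = ℚ.+-mono-≤ (2^-mono-≤ m≤n) (2^-mono-≤ m≤n)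

2^-cancel-< : ∀ {m n} → 2^ m < 2^ n → m <ℕ n
2^-cancel-< 2^m<2^n = ℕ.≰⇒> λ n≤m → ℚ.<-irrefl refl (ℚ.<-≤-trans 2^m<2^n (2^-mono-≤ n≤m))

½^-≤1 : ∀ n → ½^ n ≤ 1ℚ
½^-≤1 zero    = ℚ.≤-refl
½^-≤1 (suc n) = ℚ.≤-trans (ℚ.*-monoˡ-≤-nonNeg ½ (½^-≤1 n)) (from-yes (½ * 1ℚ ℚ.≤? 1ℚ))

½^-antimono-≤ : ∀ {m n} → m ≤ℕ n → ½^ n ≤ ½^ m
½^-antimono-≤ {n = n} z≤n = ½^-≤1 n
½^-antimono-≤ (s≤s m≤n)   = ℚ.*-monoˡ-≤-nonNeg ½ (½^-antimono-≤ m≤n)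

½^suc-≤½ : ∀ n → ½^ suc n ≤ ½
½^suc-≤½ n = ½^-antimono-≤ {1} {suc n} (s≤s z≤n)

½^-cancel-< : ∀ {m n} → ½^ m < ½^ n → n <ℕ m
½^-cancel-< ½^m<½^n = ℕ.≰⇒> λ m≤n → ℚ.<-irrefl refl (ℚ.<-≤-trans ½^m<½^n (½^-antimono-≤ m≤n))

½^-positive : ∀ n → 0ℚ < ½^ n
½^-positive zero    = 0<1
½^-positive (suc n) = ℚ.*-monoʳ-<-pos ½ (½^-positive n)

pow2-positive : ∀ {X} → Pow2 X → 0ℚ < X
pow2-positive (up n)   = ℚ.<-≤-trans 0<1 (2^-≥1 n)
pow2-positive (down n) = ½^-positive (suc n)

pow2-double : ∀ {X} → Pow2 X → Pow2 (X + X)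
pow2-double (up n)         = up (suc n)
pow2-double (down zero)    = up zero
pow2-double (down (suc n)) = subst Pow2
  (solve 1 (λ x → con ½ :* x := con ½ :* (con ½ :* x) :+ con ½ :* (con ½ :* x)) refl (½^ n))
  (down n)

pow2-half : ∀ {X} → Pow2 X → Pow2 (½ * X)
pow2-half (up zero)    = down zero
pow2-half (up (suc n)) = subst Pow2 (solve 1 (λ x → x := con ½ :* (x :+ x)) refl (2^ n)) (up n)
pow2-half (down n)     = down (suc n)

pow2-gap : ∀ {X Y} → Pow2 X → Pow2 Y → Y < X → Y + Y ≤ X
pow2-gap (up n) (up m) Y<X = 2^-mono-≤ (2^-cancel-< {m} {n} Y<X)
pow2-gap (up n) (down m) Y<X = ℚ.≤-trans (ℚ.+-mono-≤ (½^suc-≤½ m) (½^suc-≤½ m)) (2^-≥1 n)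
pow2-gap (down n) (up m) Y<X =
  ⊥-elim (ℚ.<-irrefl refl (ℚ.≤-<-trans (2^-≥1 m) (ℚ.<-≤-trans Y<X (½^-≤1 (suc n)))))
pow2-gap (down n) (down m) Y<X with ½^-cancel-< {suc m} {suc n} Y<X
... | s≤s (s≤s {n = m′} n≤m′) = begin
  ½^ suc (suc m′) + ½^ suc (suc m′)
    ≡⟨ solve 1 (λ x → con ½ :* (con ½ :* x) :+ con ½ :* (con ½ :* x) := con ½ :* x) refl (½^ m′) ⟩
  ½^ suc m′
    ≤⟨ ½^-antimono-≤ (s≤s n≤m′) ⟩
  ½^ suc n ∎
  where open ℚ.≤-Reasoning

pow2-+≡1⇒≤ : ∀ {X Y} → Pow2 X → Pow2 Y → X + Y ≡ 1ℚ → X ≤ Y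
pow2-+≡1⇒≤ {X} {Y} pX pY X+Y≡1 = +-cancelˡ-≤ X (begin
  X + X ≤⟨ pow2-gap (up 0) pX (subst (X <_) X+Y≡1 (p<p+q X (pow2-positive pY))) ⟩
  1ℚ    ≡⟨ sym X+Y≡1 ⟩
  X + Y ∎)
  where open ℚ.≤-Reasoning

pow2-+≡1⇒≡½ : ∀ {X Y} → Pow2 X → Pow2 Y → X + Y ≡ 1ℚ → X ≡ ½
pow2-+≡1⇒≡½ {X} {Y} pX pY X+Y≡1 = begin
  X           ≡⟨ solve 1 (λ x → x := con ½ :* (x :+ x)) refl X ⟩
  ½ * (X + X) ≡⟨ cong (λ Z → ½ * (X + Z)) X≡Y ⟩
  ½ * (X + Y) ≡⟨ cong (½ *_) X+Y≡1 ⟩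
  ½           ∎
  where
  open ≡-Reasoning
  X≡Y : X ≡ Y
  X≡Y = ℚ.≤-antisym (pow2-+≡1⇒≤ pX pY X+Y≡1) (pow2-+≡1⇒≤ pY pX (trans (ℚ.+-comm Y X) X+Y≡1))

pow2-≡1+⇒≡1 : ∀ {X Y} → Pow2 X → Pow2 Y → X ≡ 1ℚ + Y → Y ≡ 1ℚ
pow2-≡1+⇒≡1 {X} {Y} pX pY X≡1+Y = ℚ.≤-antisym Y≤1 1≤Y
  where
  open ℚ.≤-Reasoning
  Y≤1 : Y ≤ 1ℚ
  Y≤1 = +-cancelʳ-≤ Y (begin
    Y + Y  ≤⟨ pow2-gap pX pY (subst (Y <_) (trans (ℚ.+-comm Y 1ℚ) (sym X≡1+Y)) (p<p+q Y 0<1)) ⟩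
    X      ≡⟨ X≡1+Y ⟩
    1ℚ + Y ∎)
  1≤Y : 1ℚ ≤ Y
  1≤Y = +-cancelˡ-≤ 1ℚ (begin
    1ℚ + 1ℚ ≤⟨ pow2-gap pX (up 0) (subst (1ℚ <_) (sym X≡1+Y) (p<p+q 1ℚ (pow2-positive pY))) ⟩
    X       ≡⟨ X≡1+Y ⟩
    1ℚ + Y  ∎)

data Sign : Set where
  -1ₛ 0ₛ 1ₛ : Sign

_·_ : Sign → ℚ → ℚ
-1ₛ · X = - X
0ₛ  · X = 0ℚ
1ₛ  · X = X

·-as-* : ∀ s X → (s · 1ℚ) * X ≡ s · X
·-as-* -1ₛ X = solve 1 (λ x → con (- 1ℚ) :* x := :- x) refl X
·-as-* 0ₛ  X = ℚ.*-zeroˡ X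
·-as-* 1ₛ  X = ℚ.*-identityˡ X

⟨_,_⟩ : Sign → Sign → ℚi
⟨ s , t ⟩ = (s · 1ℚ) +i (t · 1ℚ)

_⋆_ : ℚi → ℚ → ℚi
z ⋆ X = (re z * X) +i (im z * X)

⟨⟩-⋆ : ∀ s t X → ⟨ s , t ⟩ ⋆ X ≡ (s · X) +i (t · X)
⟨⟩-⋆ s t X = cong₂ _+i_ (·-as-* s X) (·-as-* t X)

⋆-assoc : ∀ z r X → (z ⋆ r) ⋆ X ≡ z ⋆ (r * X)
⋆-assoc z r X = cong₂ _+i_ (ℚ.*-assoc (re z) r X) (ℚ.*-assoc (im z) r X)

*ᵢ-⋆-assoc : ∀ g z X → g *ᵢ (z ⋆ X) ≡ (g *ᵢ z) ⋆ X
*ᵢ-⋆-assoc (a +i b) (c +i d) X = cong₂ _+i_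
  (solve 5 (λ a b c d x → a :* (c :* x) :- b :* (d :* x) := (a :* c :- b :* d) :* x) refl a b c d X)
  (solve 5 (λ a b c d x → a :* (d :* x) :+ b :* (c :* x) := (a :* d :+ b :* c) :* x) refl a b c d X)

*ᵢ-assoc : ∀ x y z → (x *ᵢ y) *ᵢ z ≡ x *ᵢ (y *ᵢ z)
*ᵢ-assoc (a +i b) (c +i d) (e +i f) = cong₂ _+i_
  (solve 6 (λ a b c d e f → (a :* c :- b :* d) :* e :- (a :* d :+ b :* c) :* f
                          := a :* (c :* e :- d :* f) :- b :* (c :* f :+ d :* e)) refl a b c d e f)
  (solve 6 (λ a b c d e f → (a :* c :- b :* d) :* f :+ (a :* d :+ b :* c) :* e
                          := a :* (c :* f :+ d :* e) :+ b :* (c :* e :- d :* f)) refl a b c d e f)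

*ᵢ-identityˡ : ∀ z → 𝟙 *ᵢ z ≡ z
*ᵢ-identityˡ (a +i b) = cong₂ _+i_
  (solve 2 (λ a b → con 1ℚ :* a :- con 0ℚ :* b := a) refl a b)
  (solve 2 (λ a b → con 1ℚ :* b :+ con 0ℚ :* a := b) refl a b)

data SignedPow2 (p : ℚi) : Set where
  signed : ∀ s t {X} → Pow2 X → p ≡ (s · X) +i (t · X) → SignedPow2 p

record SignedProduct (g : ℚi) (s t : Sign) : Set where
  constructor sp
  field
    s′ t′   : Sign
    r       : ℚ
    pow2-r* : ∀ {X} → Pow2 X → Pow2 (r * X)
    product : g *ᵢ ⟨ s , t ⟩ ≡ ⟨ s′ , t′ ⟩ ⋆ r

×1 : ∀ {X} → Pow2 X → Pow2 (1ℚ * X)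
×1 {X} = subst Pow2 (sym (ℚ.*-identityˡ X))

×2 : ∀ {X} → Pow2 X → Pow2 (2ℚ * X)
×2 {X} = subst Pow2 (solve 1 (λ x → x :+ x := (con 1ℚ :+ con 1ℚ) :* x) refl X) ∘′ pow2-double

𝕚-products : ∀ s t → SignedProduct 𝕚 s t
𝕚-products -1ₛ -1ₛ = sp 1ₛ -1ₛ 1ℚ ×1 refl
𝕚-products -1ₛ 0ₛ  = sp 0ₛ -1ₛ 1ℚ ×1 refl
𝕚-products -1ₛ 1ₛ  = sp -1ₛ -1ₛ 1ℚ ×1 refl
𝕚-products 0ₛ -1ₛ  = sp 1ₛ 0ₛ 1ℚ ×1 refl
𝕚-products 0ₛ 0ₛ   = sp 0ₛ 0ₛ 1ℚ ×1 refl
𝕚-products 0ₛ 1ₛ   = sp -1ₛ 0ₛ 1ℚ ×1 refl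
𝕚-products 1ₛ -1ₛ  = sp 1ₛ 1ₛ 1ℚ ×1 refl
𝕚-products 1ₛ 0ₛ   = sp 0ₛ 1ₛ 1ℚ ×1 refl
𝕚-products 1ₛ 1ₛ   = sp -1ₛ 1ₛ 1ℚ ×1 refl

one-i-products : ∀ s t → SignedProduct one-i s t
one-i-products -1ₛ -1ₛ = sp -1ₛ 0ₛ 2ℚ ×2 refl
one-i-products -1ₛ 0ₛ  = sp -1ₛ 1ₛ 1ℚ ×1 refl
one-i-products -1ₛ 1ₛ  = sp 0ₛ 1ₛ 2ℚ ×2 refl
one-i-products 0ₛ -1ₛ  = sp -1ₛ -1ₛ 1ℚ ×1 refl
one-i-products 0ₛ 0ₛ   = sp 0ₛ 0ₛ 1ℚ ×1 refl
one-i-products 0ₛ 1ₛ   = sp 1ₛ 1ₛ 1ℚ ×1 refl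
one-i-products 1ₛ -1ₛ  = sp 0ₛ -1ₛ 2ℚ ×2 refl
one-i-products 1ₛ 0ₛ   = sp 1ₛ -1ₛ 1ℚ ×1 refl
one-i-products 1ₛ 1ₛ   = sp 1ₛ 0ₛ 2ℚ ×2 refl

one-i⁻¹-products : ∀ s t → SignedProduct one-i⁻¹ s t
one-i⁻¹-products -1ₛ -1ₛ = sp 0ₛ -1ₛ 1ℚ ×1 refl
one-i⁻¹-products -1ₛ 0ₛ  = sp -1ₛ -1ₛ ½ pow2-half refl
one-i⁻¹-products -1ₛ 1ₛ  = sp -1ₛ 0ₛ 1ℚ ×1 refl
one-i⁻¹-products 0ₛ -1ₛ  = sp 1ₛ -1ₛ ½ pow2-half refl
one-i⁻¹-products 0ₛ 0ₛ   = sp 0ₛ 0ₛ 1ℚ ×1 refl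
one-i⁻¹-products 0ₛ 1ₛ   = sp -1ₛ 1ₛ ½ pow2-half refl
one-i⁻¹-products 1ₛ -1ₛ  = sp 1ₛ 0ₛ 1ℚ ×1 refl
one-i⁻¹-products 1ₛ 0ₛ   = sp 1ₛ 1ₛ ½ pow2-half refl
one-i⁻¹-products 1ₛ 1ₛ   = sp 0ₛ 1ₛ 1ℚ ×1 refl

*-signed : ∀ {g q} → (∀ s t → SignedProduct g s t) → SignedPow2 q → SignedPow2 (g *ᵢ q)
*-signed {g} products (signed s t {X} pX refl) with products s t
... | sp s′ t′ r pow2-r* product = signed s′ t′ (pow2-r* pX) (begin
  g *ᵢ ((s · X) +i (t · X))        ≡⟨ cong (g *ᵢ_) (sym (⟨⟩-⋆ s t X)) ⟩
  g *ᵢ (⟨ s , t ⟩ ⋆ X)             ≡⟨ *ᵢ-⋆-assoc g ⟨ s , t ⟩ X ⟩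
  (g *ᵢ ⟨ s , t ⟩) ⋆ X             ≡⟨ cong (_⋆ X) product ⟩
  (⟨ s′ , t′ ⟩ ⋆ r) ⋆ X            ≡⟨ ⋆-assoc ⟨ s′ , t′ ⟩ r X ⟩
  ⟨ s′ , t′ ⟩ ⋆ (r * X)            ≡⟨ ⟨⟩-⋆ s′ t′ (r * X) ⟩
  (s′ · (r * X)) +i (t′ · (r * X)) ∎)
  where open ≡-Reasoning

pow-signed : ∀ {g} → (∀ s t → SignedProduct g s t) → ∀ n → SignedPow2 (pow g n)
pow-signed products zero    = signed 1ₛ 0ₛ (up 0) refl
pow-signed products (suc n) = *-signed products (pow-signed products n)

zpow-one-i-signed : ∀ n → SignedPow2 (zpow-one-i n)
zpow-one-i-signed (+ n)    = pow-signed one-i-products n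
zpow-one-i-signed -[1+ n ] = pow-signed one-i⁻¹-products (suc n)

𝕚-pow-*-signed : ∀ a {q} → SignedPow2 q → SignedPow2 (pow 𝕚 a *ᵢ q)
𝕚-pow-*-signed zero    {q} sq = subst SignedPow2 (sym (*ᵢ-identityˡ q)) sq
𝕚-pow-*-signed (suc a) {q} sq =
  subst SignedPow2 (sym (*ᵢ-assoc 𝕚 (pow 𝕚 a) q)) (*-signed 𝕚-products (𝕚-pow-*-signed a sq))

inP⇒signed : ∀ {p} → InP p → SignedPow2 p
inP⇒signed (inj₁ refl)           = signed 0ₛ 0ₛ (up 0) refl
inP⇒signed (inj₂ (a , n , refl)) = 𝕚-pow-*-signed a (zpow-one-i-signed n)

data UnitSplit : Sign → Sign → ℚ → ℚ → Set where
  0+1  : ∀ {X} → UnitSplit 0ₛ 1ₛ X 1ℚ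
  1+0  : ∀ {Y} → UnitSplit 1ₛ 0ₛ 1ℚ Y
  ½+½  : UnitSplit 1ₛ 1ₛ ½ ½
  2-1  : UnitSplit 1ₛ -1ₛ 2ℚ 1ℚ
  -1+2 : UnitSplit -1ₛ 1ₛ 1ℚ 2ℚ

data ZeroSplit : Sign → Sign → ℚ → ℚ → Set where
  0+0  : ∀ {X Y} → ZeroSplit 0ₛ 0ₛ X Y
  1-1  : ∀ {X} → ZeroSplit 1ₛ -1ₛ X X
  -1+1 : ∀ {X} → ZeroSplit -1ₛ 1ₛ X X

1--p≡1+p : ∀ X → 1ℚ - - X ≡ 1ℚ + X
1--p≡1+p X = cong (λ Z → 1ℚ + Z) (⁻¹-involutive X)

0<1+pow2 : ∀ {X} → Pow2 X → 0ℚ < 1ℚ + X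
0<1+pow2 pX = ℚ.<-trans 0<1 (p<p+q 1ℚ (pow2-positive pX))

unit-split : ∀ a c {X Y} → Pow2 X → Pow2 Y → 1ℚ - a · X ≡ c · Y → UnitSplit a c X Y
unit-split 0ₛ 0ₛ pX pY ()
unit-split 0ₛ 1ₛ pX pY refl = 0+1
unit-split 0ₛ -1ₛ pX pY e = ⊥-elim (ℚ.<⇒≢ (ℚ.<-trans (neg<0 (pow2-positive pY)) 0<1) (sym e))
unit-split 1ₛ 0ₛ {X} {Y} pX pY e = subst (λ Z → UnitSplit 1ₛ 0ₛ Z Y) (x∙y⁻¹≈ε⇒x≈y 1ℚ X e) 1+0
unit-split 1ₛ 1ₛ {X} {Y} pX pY e = subst₂ (UnitSplit 1ₛ 1ₛ)
  (sym (pow2-+≡1⇒≡½ pX pY X+Y≡1)) (sym (pow2-+≡1⇒≡½ pY pX (trans (ℚ.+-comm Y X) X+Y≡1))) ½+½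
  where
  X+Y≡1 : X + Y ≡ 1ℚ
  X+Y≡1 = trans (cong (λ Z → X + Z) (sym e)) (solve 1 (λ x → x :+ (con 1ℚ :- x) := con 1ℚ) refl X)
unit-split 1ₛ -1ₛ {X} {Y} pX pY e =
  subst₂ (UnitSplit 1ₛ -1ₛ) (sym (trans X≡1+Y (cong (λ Z → 1ℚ + Z) Y≡1))) (sym Y≡1) 2-1
  where
  X≡1+Y : X ≡ 1ℚ + Y
  X≡1+Y = begin
    X               ≡⟨ solve 1 (λ x → x := con 1ℚ :+ (:- (con 1ℚ :- x))) refl X ⟩
    1ℚ + - (1ℚ - X) ≡⟨ cong (λ Z → 1ℚ + - Z) e ⟩
    1ℚ - - Y        ≡⟨ 1--p≡1+p Y ⟩
    1ℚ + Y          ∎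
    where open ≡-Reasoning
  Y≡1 : Y ≡ 1ℚ
  Y≡1 = pow2-≡1+⇒≡1 pX pY X≡1+Y
unit-split -1ₛ 0ₛ {X} pX pY e = ⊥-elim (ℚ.<⇒≢ (0<1+pow2 pX) (sym (trans (sym (1--p≡1+p X)) e)))
unit-split -1ₛ 1ₛ {X} {Y} pX pY e =
  subst₂ (UnitSplit -1ₛ 1ₛ) (sym X≡1) (sym (trans Y≡1+X (cong (λ Z → 1ℚ + Z) X≡1))) -1+2
  where
  Y≡1+X : Y ≡ 1ℚ + X
  Y≡1+X = trans (sym e) (1--p≡1+p X)
  X≡1 : X ≡ 1ℚ
  X≡1 = pow2-≡1+⇒≡1 pY pX Y≡1+X
unit-split -1ₛ -1ₛ {X} pX pY e =
  ⊥-elim (ℚ.<⇒≢ (ℚ.<-trans (neg<0 (pow2-positive pY)) (0<1+pow2 pX)) (trans (sym e) (1--p≡1+p X)))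

0-p≡-p : ∀ X → 0ℚ - X ≡ - X
0-p≡-p X = ℚ.+-identityˡ (- X)

0--p≡p : ∀ X → 0ℚ - - X ≡ X
0--p≡p X = trans (0-p≡-p (- X)) (⁻¹-involutive X)

zero-split : ∀ b d {X Y} → 0ℚ < X → 0ℚ < Y → 0ℚ - b · X ≡ d · Y → ZeroSplit b d X Y
zero-split 0ₛ 0ₛ 0<X 0<Y e = 0+0
zero-split 0ₛ 1ₛ 0<X 0<Y e = ⊥-elim (ℚ.<⇒≢ 0<Y e)
zero-split 0ₛ -1ₛ 0<X 0<Y e = ⊥-elim (ℚ.<⇒≢ (neg<0 0<Y) (sym e))
zero-split 1ₛ 0ₛ {X} 0<X 0<Y e = ⊥-elim (ℚ.<⇒≢ (neg<0 0<X) (trans (sym (0-p≡-p X)) e))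
zero-split 1ₛ 1ₛ {X} 0<X 0<Y e =
  ⊥-elim (ℚ.<⇒≢ (ℚ.<-trans (neg<0 0<X) 0<Y) (trans (sym (0-p≡-p X)) e))
zero-split 1ₛ -1ₛ {X} 0<X 0<Y e =
  subst (ZeroSplit 1ₛ -1ₛ X) (ℚ.neg-injective (trans (sym (0-p≡-p X)) e)) 1-1
zero-split -1ₛ 0ₛ {X} 0<X 0<Y e = ⊥-elim (ℚ.<⇒≢ 0<X (sym (trans (sym (0--p≡p X)) e)))
zero-split -1ₛ 1ₛ {X} 0<X 0<Y e = subst (ZeroSplit -1ₛ 1ₛ X) (trans (sym (0--p≡p X)) e) -1+1
zero-split -1ₛ -1ₛ {X} 0<X 0<Y e =
  ⊥-elim (ℚ.<⇒≢ (ℚ.<-trans (neg<0 0<Y) 0<X) (sym (trans (sym (0--p≡p X)) e)))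

𝓕 : List ℚi
𝓕 = 𝟘 ∷ 𝟙 ∷ ((- 1ℚ) +i 0ℚ) ∷ ((+ 2 / 1) +i 0ℚ) ∷ (½ +i 0ℚ) ∷ 𝕚 ∷ (1ℚ +i 1ℚ)
  ∷ (½ +i ½) ∷ (1ℚ +i (- 1ℚ)) ∷ (½ +i -½) ∷ (0ℚ +i (- 1ℚ)) ∷ []

_≟ᵢ_ : DecidableEquality ℚi
(a +i b) ≟ᵢ (c +i d) =
  map′ (λ (a≡c , b≡d) → cong₂ _+i_ a≡c b≡d) (λ e → cong re e , cong im e) (a ≟ c ×-dec b ≟ d)

open import Data.List.Membership.DecPropositional _≟ᵢ_ using (_∈?_)

∈𝓕 : ∀ {p} {p∈?𝓕 : True (p ∈? 𝓕)} → p ∈ 𝓕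
∈𝓕 {p∈?𝓕 = p∈?𝓕} = toWitness p∈?𝓕

-- 2-1 and -1+2 cannot meet 1-1 or -1+1, which would need 2ℚ ≡ 1ℚ.
signed-complement-∈𝓕 : ∀ a b c d {X Y} → Pow2 X → Pow2 Y →
  1ℚ - a · X ≡ c · Y → 0ℚ - b · X ≡ d · Y → (a · X) +i (b · X) ∈ 𝓕
signed-complement-∈𝓕 a b c d pX pY re≡ im≡
  with unit-split a c pX pY re≡ | zero-split b d (pow2-positive pX) (pow2-positive pY) im≡
... | 0+1  | 0+0  = ∈𝓕
... | 0+1  | 1-1  = ∈𝓕
... | 0+1  | -1+1 = ∈𝓕
... | 1+0  | 0+0  = ∈𝓕
... | 1+0  | 1-1  = ∈𝓕
... | 1+0  | -1+1 = ∈𝓕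
... | ½+½  | 0+0  = ∈𝓕
... | ½+½  | 1-1  = ∈𝓕
... | ½+½  | -1+1 = ∈𝓕
... | 2-1  | 0+0  = ∈𝓕
... | -1+2 | 0+0  = ∈𝓕

fundamental⇒∈𝓕 : ∀ {p} → Fundamental p → p ∈ 𝓕
fundamental⇒∈𝓕 (p∈ℍ₂ , 1-p∈ℍ₂) with inP⇒signed p∈ℍ₂
... | signed a b pX refl with inP⇒signed 1-p∈ℍ₂
... | signed c d pY 1-p≡ = signed-complement-∈𝓕 a b c d pX pY (cong re 1-p≡) (cong im 1-p≡)

unit : ∀ {p} a n → p ≡ pow 𝕚 a *ᵢ zpow-one-i n → InP p
unit a n p≡ = inj₂ (a , n , p≡)

𝓕-fundamental : All Fundamental 𝓕
𝓕-fundamental =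
    (inj₁ refl              , unit 0 (+ 0) refl)
  ∷ (unit 0 (+ 0) refl      , inj₁ refl)
  ∷ (unit 2 (+ 0) refl      , unit 1 (+ 2) refl)
  ∷ (unit 1 (+ 2) refl      , unit 2 (+ 0) refl)
  ∷ (unit 3 -[1+ 1 ] refl   , unit 3 -[1+ 1 ] refl)
  ∷ (unit 1 (+ 0) refl      , unit 0 (+ 1) refl)
  ∷ (unit 1 (+ 1) refl      , unit 3 (+ 0) refl)
  ∷ (unit 0 -[1+ 0 ] refl   , unit 3 -[1+ 0 ] refl)
  ∷ (unit 0 (+ 1) refl      , unit 1 (+ 0) refl)
  ∷ (unit 3 -[1+ 0 ] refl   , unit 0 -[1+ 0 ] refl)
  ∷ (unit 3 (+ 0) refl      , unit 1 (+ 1) refl)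
  ∷ []

lemma16 : (p : ℚi) → InR p →
    Fundamental p ⇔
    (p ∈ (𝟘 ∷ 𝟙 ∷ ((- 1ℚ) +i 0ℚ) ∷ ((+ 2 / 1) +i 0ℚ) ∷ (½ +i 0ℚ) ∷ 𝕚 ∷ (1ℚ +i 1ℚ)
    ∷ (½ +i ½) ∷ (1ℚ +i (- 1ℚ)) ∷ (½ +i -½) ∷ (0ℚ +i (- 1ℚ)) ∷ []))
lemma16 p _ = mk⇔ fundamental⇒∈𝓕 (All-lookup 𝓕-fundamental)
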